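{- Let $T$ be a string of length $N$ and let $\mathsf{TtoG}(T)$ be as defined in the context. For any substring $w$ of $T$, the sequence $\mathit{PSeq}(w)$ consists of $O(\lg N)$ blocks of letters (and generates $w$). Moreover, for every position $i$, $w$ occurs at position $i$ in $T$ if and only if $\mathit{PSeq}(w)$ occurs at position $i$, i.e., there is a chain in the derivation tree of $\mathsf{TtoG}(T)$ labeled with $\mathit{PSeq}(w)$ and beginning at position $i$.
   Context: A block of a string $u$ is a maximal run $u[i..j]=c^d$ of one character ($d\ge1$, and $u[i-1]\ne c$ or $i=1$, and $u[j+1]\neq c$ or $j=|u|$). A run-length SLP (RLSLP) is a grammar whose rules are of the form $X\to a$ (terminal), $X\to YZ$, or $X\to Y^d$ ($d\ge2$); $\mathrm{val}(X)$ is the string derived by $X$, and $\mathrm{val}$ of a sequence is the concatenation. Algorithm $\mathsf{TtoG}$: let $T_0$ be obtained from $T$ by replacing each character $c$ by a letter (nonterminal) with rule $\to c$. For $h=0,1,2,\dots$ until $|T_h|=1$: if $h$ is even ($\mathsf{BComp}$), let $B_h$ be the set of letters $c$ for which $T_h$ has a block $c^d$ with $d\ge 2$, and obtain $T_{h+1}$ by replacing every block $c^d$ with $d\ge2$ by a letter with rule $\to c^d$ (equal pairs $(c,d)$ get the same fresh letter, distinct pairs distinct fresh letters); if $h$ is odd ($\mathsf{PComp}$; at this point $T_h$ has no block of length $\ge2$), choose a partition $(L_h,R_h)$ of the set of letters occurring in $T_h$ such that at least $(|T_h|-1)/4$ occurrences of pairs in $L_hR_h$ exist in $T_h$, and obtain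 $T_{h+1}$ by replacing every occurrence of a pair $ab$ with $a\in L_h$, $b\in R_h$ by a letter with rule $\to ab$ (same pair, same fresh letter). $\mathsf{TtoG}(T)$ is the RLSLP of all letters and rules so produced. Derivation tree: the derivation tree of $\mathsf{TtoG}(T)$ with terminal leaves removed, each node labeled by a letter and spanning an interval of positions of $T$. A chain is a sequence $v_1\cdots v_m$ of nodes such that for each $i<m$ the beginning position of $v_{i+1}$ is the ending position of $v_i$ plus one; it is labeled with the sequence of labels of its nodes, and a sequence $p$ of letters occurs at position $i$ if some chain labeled $p$ begins at $i$. Popped sequence: for $w=T[b..e]$, let $w_0=T_0[b..e]$. For increasing $h\ge0$, given $w_h$: if $h$ is even, pop out the leftmost block of $w_h$ if it is a block of a letter in $B_h$ and the rightmost block of (the remainder of) $w_h$ if it is a block of a letter in $B_h$, then obtain $w_{h+1}$ by applying to the remainder the same block replacement as in $\mathsf{BComp}$ of level $h$; if $h$ is odd, pop out the leftmost letter of $w_h$ if it lies in $R_h$ and the rightmost letter of (the remainder of) $w_h$ if it lies in $L_h$, then obtain $w_{h+1}$ by replacing pairs in $L_hR_h$ by the same letters as in $\mathsf{PComp}$ of level $h$. Iterate until the string is empty. $\mathit{PSeq}(w)$ is the concatenation of the left-popped letters/blocks in increasing order of level followed by the right-popped letters/blocks in decreasing order of level; thus $\mathrm{val}(\mathit{PSeq}(w))=w$. -}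

module Defs where

open import Data.Bool using (Bool; true; false; if_then_else_; _∧_; not)
open import Data.Nat using (ℕ; zero; suc; _+_; _*_; _≤_; _≤ᵇ_)
open import Data.Fin using (Fin; toℕ)
open import Data.List using (List; []; _∷_; _++_; length; replicate; reverse; concat; concatMap; map; take; drop)
open import Data.Bool.ListAction using (any)
open import Data.Empty using (⊥)
open import Data.Product using (_×_; _,_; proj₁; proj₂)
open import Data.Unit using (⊤)
open import Relation.Binary.PropositionalEquality using (_≡_; refl; _≢_)
open import Relation.Binary.Definitions using (DecidableEquality)
open import Relation.Nullary using (yes; no; does)
import Data.Nat.Properties as ℕP

-- Everything is parameterised by an alphabet A with decidable equality.
-- Positions in strings are 0-based.

module TtoG {A : Set} (_≟A_ : DecidableEquality A) where

  -- Letters (nonterminals) are represented by their rule, i.e. hash-consed: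
  --   term c   : rule X → c
  --   pair Y Z : rule X → Y Z
  --   pow Y d  : rule X → Y^d
  -- so "equal pairs get the same letter, distinct pairs distinct letters".
  data Letter : Set where
    term : A → Letter
    pair : Letter → Letter → Letter
    pow  : Letter → ℕ → Letter

  private
    term-inj : ∀ {a b} → term a ≡ term b → a ≡ b
    term-inj refl = refl
    pair-inj₁ : ∀ {a b c d} → pair a b ≡ pair c d → a ≡ c
    pair-inj₁ refl = refl
    pair-inj₂ : ∀ {a b c d} → pair a b ≡ pair c d → b ≡ d
    pair-inj₂ refl = refl
    pow-inj₁ : ∀ {a b c d} → pow a b ≡ pow c d → a ≡ c
    pow-inj₁ refl = refl
    pow-inj₂ : ∀ {a b c d} → pow a b ≡ pow c d → b ≡ d
    pow-inj₂ refl = refl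

  _≟L_ : DecidableEquality Letter
  term a ≟L term b with a ≟A b
  ... | yes refl = yes refl
  ... | no ne = no (λ e → ne (term-inj e))
  term _ ≟L pair _ _ = no (λ ())
  term _ ≟L pow _ _ = no (λ ())
  pair _ _ ≟L term _ = no (λ ())
  pair a b ≟L pair c d with a ≟L c | b ≟L d
  ... | yes refl | yes refl = yes refl
  ... | no ne | _ = no (λ e → ne (pair-inj₁ e))
  ... | yes _ | no ne = no (λ e → ne (pair-inj₂ e))
  pair _ _ ≟L pow _ _ = no (λ ())
  pow _ _ ≟L term _ = no (λ ())
  pow _ _ ≟L pair _ _ = no (λ ())
  pow a b ≟L pow c d with a ≟L c | b ℕP.≟ d
  ... | yes refl | yes refl = yes refl
  ... | no ne | _ = no (λ e → ne (pow-inj₁ e))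
  ... | yes _ | no ne = no (λ e → ne (pow-inj₂ e))

  val : Letter → List A
  val (term c) = c ∷ []
  val (pair Y Z) = val Y ++ val Z
  val (pow Y d) = concat (replicate d (val Y))

  valSeq : List Letter → List A
  valSeq = concatMap val

  blocks : List Letter → List (Letter × ℕ)
  blocks [] = []
  blocks (a ∷ u) with blocks u
  ... | [] = (a , 1) ∷ []
  ... | (b , d) ∷ r = if does (a ≟L b) then (b , suc d) ∷ r else (a , 1) ∷ (b , d) ∷ r

  numBlocks : List Letter → ℕ
  numBlocks u = length (blocks u)

  inB : List Letter → Letter → Bool
  inB u c = any (λ bd → does (c ≟L proj₁ bd) ∧ (2 ≤ᵇ proj₂ bd)) (blocks u)

  compressBlocks : List (Letter × ℕ) → List Letter
  compressBlocks = concatMap (λ bd → if 2 ≤ᵇ proj₂ bd then pow (proj₁ bd) (proj₂ bd) ∷ [] else proj₁ bd ∷ [])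

  bcomp : List Letter → List Letter
  bcomp u = compressBlocks (blocks u)

  -- PComp w.r.t. a partition given by p : Letter → Bool (L = p true, R = p false).
  -- Occurrences of pairs in LR never overlap, so left-to-right replacement
  -- replaces every occurrence.
  inLR : (Letter → Bool) → Letter → Letter → Bool
  inLR p a b = p a ∧ not (p b)

  pcomp : (Letter → Bool) → List Letter → List Letter
  pcomp p [] = []
  pcomp p (a ∷ []) = a ∷ []
  pcomp p (a ∷ bu@(b ∷ u)) = if inLR p a b then pair a b ∷ pcomp p u else a ∷ pcomp p bu

  pairCount : (Letter → Bool) → List Letter → ℕ
  pairCount p [] = 0
  pairCount p (a ∷ []) = 0
  pairCount p (a ∷ bu@(b ∷ u)) = (if inLR p a b then 1 else 0) + pairCount p bu

  -- A run of TtoG is recorded as the list of steps performed at levels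
  -- h = 0, 1, 2, ... : BComp at even levels, PComp with a chosen partition
  -- at odd levels.
  data Step : Set where
    bstep : Step
    pstep : (Letter → Bool) → Step

  applyStep : Step → List Letter → List Letter
  applyStep bstep u = bcomp u
  applyStep (pstep p) u = pcomp p u

  applySteps : List Step → List Letter → List Letter
  applySteps [] u = u
  applySteps (s ∷ ss) u = applySteps ss (applyStep s u)

  -- the step is allowed at a level of the given parity (true = even level)
  StepOK : Bool → Step → List Letter → Set
  StepOK true bstep u = ⊤
  StepOK true (pstep _) u = ⊥
  StepOK false bstep u = ⊥
  StepOK false (pstep p) u = length u ≤ 4 * pairCount p u + 1

  -- Valid u even ss : starting from T_h = u at a level of parity `even`,
  -- the steps ss are a legal continuation of TtoG, which stops exactly
  -- at the first level whose string has length 1.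
  Valid : List Letter → Bool → List Step → Set
  Valid u e [] = length u ≡ 1
  Valid u e (s ∷ ss) = (length u ≢ 1) × StepOK e s u × Valid (applyStep s u) (not e) ss

  initial : List A → List Letter
  initial = map term

  IsRun : List A → List Step → Set
  IsRun T ss = Valid (initial T) true ss

  -- the final string T_H (of length 1 for a legal run); its letter is the start symbol
  result : List A → List Step → List Letter
  result T ss = applySteps ss (initial T)

  -- Derivation tree of the start symbol `root` (terminal leaves removed):
  -- Node root X i  : there is a node labelled X beginning at position i.
  data Node : Letter → Letter → ℕ → Set where
    here  : ∀ {X} → Node X X 0
    left  : ∀ {Y Z X i} → Node Y X i → Node (pair Y Z) X i
    right : ∀ {Y Z X i} → Node Z X i → Node (pair Y Z) X (length (val Y) + i)
    child : ∀ {Y d X i} (k : Fin d) → Node Y X i → Node (pow Y d) X (toℕ k * length (val Y) + i)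

  ChainAt : Letter → List Letter → ℕ → Set
  ChainAt root [] i = ⊤
  ChainAt root (X ∷ xs) i = Node root X i × ChainAt root xs (i + length (val X))

  OccursAt : List A → List A → ℕ → Set
  OccursAt w T i = take (length w) (drop i T) ≡ w

  popLeftB : List Letter → List (Letter × ℕ) → List Letter × List (Letter × ℕ)
  popLeftB u [] = [] , []
  popLeftB u ((c , d) ∷ r) = if inB u c then (replicate d c , r) else ([] , (c , d) ∷ r)

  popRightB : List Letter → List (Letter × ℕ) → List Letter × List (Letter × ℕ)
  popRightB u r with reverse r
  ... | [] = [] , []
  ... | (c , d) ∷ r' = if inB u c then (replicate d c , reverse r') else ([] , r)

  popLeftP : (Letter → Bool) → List Letter → List Letter × List Letter
  popLeftP p [] = [] , []
  popLeftP p (a ∷ w) = if p a then ([] , a ∷ w) else (a ∷ [] , w)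

  popRightP : (Letter → Bool) → List Letter → List Letter × List Letter
  popRightP p w with reverse w
  ... | [] = [] , []
  ... | a ∷ w' = if p a then (a ∷ [] , reverse w') else ([] , w)

  -- pseq ss u w : ss = remaining steps, u = T_h, w = w_h.
  -- Result: left-popped (increasing level) ++ leftover ++ right-popped
  -- (decreasing level).  The leftover is nonempty only when w = T (then it
  -- is the single letter of T_H, i.e. the start symbol).
  pseq : List Step → List Letter → List Letter → List Letter
  pseq [] u w = w
  pseq (bstep ∷ ss) u w =
    let l = popLeftB u (blocks w)
        r = popRightB u (proj₂ l)
    in proj₁ l ++ pseq ss (bcomp u) (compressBlocks (proj₂ r)) ++ proj₁ r
  pseq (pstep p ∷ ss) u w =
    let l = popLeftP p w
        r = popRightP p (proj₂ l)
    in proj₁ l ++ pseq ss (pcomp p u) (pcomp p (proj₂ r)) ++ proj₁ r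

  PSeq : List A → List Step → List A → List Letter
  PSeq T ss w = pseq ss (initial T) (initial w)

module Submission where

-- Write T_h = x ++ w_h ++ y.  What PSeq pops from the ends of w_h is exactly
-- what could merge with letters outside w_h, so compressing T_h splits as
-- compress(x ++ L) ++ w_{h+1} ++ compress(R ++ y) (the level split).  Hence,
-- by induction on the levels, PSeq(w) = L_0 L_1 ... w_H ... R_1 R_0 labels a
-- chain of consecutive nodes starting at |x|, with at most two blocks per
-- level; a pair-compression level shrinks the string by a factor 3/4, so
-- there are O(lg N) levels.  Conversely a chain spells out its value where
-- it starts, so a chain labelled PSeq(w) at i forces an occurrence of w.

open import Defs
open import Data.Bool using (Bool; true; false; if_then_else_; _∧_)
open import Data.Bool.Properties using (∧-zeroʳ; ∨-zeroʳ)
open import Data.Bool.ListAction using (any)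
open import Data.Nat using (ℕ; zero; suc; _+_; _*_; _≤_; _<_; _∸_; _^_; _⊓_; z≤n; s≤s; _≤ᵇ_; _<?_; _≤?_)
open import Data.Nat.Properties
open import Data.Nat.Logarithm using (⌊log₂_⌋; ⌊log₂⌋-mono-≤; ⌊log₂[2^n]⌋≡n)
open import Data.Nat.Solver using (module +-*-Solver)
open import Data.Fin using (toℕ; fromℕ<)
open import Data.Fin.Properties using (toℕ-fromℕ<; toℕ<n)
open import Data.List using (List; []; _∷_; _++_; length; replicate; reverse; concat; concatMap; take; drop)
open import Data.List.Properties
open import Data.List.Relation.Unary.Any using (Any; here; there)
open import Data.Product using (Σ; _×_; _,_; proj₁; proj₂)
open import Data.Sum using (_⊎_; inj₁; inj₂)
open import Data.Empty using (⊥; ⊥-elim)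
open import Data.Unit using (⊤; tt)
open import Function.Bundles using (_⇔_; mk⇔)
open import Relation.Binary.PropositionalEquality
open import Relation.Binary.Definitions using (DecidableEquality)
open import Relation.Nullary using (yes; no; does)
open +-*-Solver

module _ {B : Set} where

  unsnoc : (xs : List B) → xs ≢ [] → Σ (List B) λ ys → Σ B λ z → xs ≡ ys ++ z ∷ []
  unsnoc [] ne = ⊥-elim (ne refl)
  unsnoc (x ∷ []) _ = [] , x , refl
  unsnoc (x ∷ x' ∷ xs) _ with unsnoc (x' ∷ xs) (λ ())
  ... | ys , z , e = x ∷ ys , z , cong (x ∷_) e

  -- Reading the shape of xs off the shape of reverse xs (the right-popping
  -- functions inspect `reverse`).
  reverse-≡[] : (xs : List B) → reverse xs ≡ [] → xs ≡ []
  reverse-≡[] xs e = trans (sym (reverse-involutive xs)) (cong reverse e)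

  reverse-≡∷ : (xs : List B) (z : B) (r : List B) → reverse xs ≡ z ∷ r → xs ≡ reverse r ++ z ∷ []
  reverse-≡∷ xs z r e = trans (sym (reverse-involutive xs)) (trans (cong reverse e) (unfold-reverse z r))

  replicate-snoc : (k : ℕ) (c : B) → replicate (suc k) c ≡ replicate k c ++ c ∷ []
  replicate-snoc zero c = refl
  replicate-snoc (suc k) c = cong (c ∷_) (replicate-snoc k c)

  last-of-replicate : ∀ s k (c : B) s₀ a → s ++ replicate (suc k) c ≡ s₀ ++ a ∷ [] → a ≡ c
  last-of-replicate s k c s₀ a e =
    sym (∷ʳ-injectiveʳ (s ++ replicate k c) s₀
      (trans (++-assoc s (replicate k c) (c ∷ [])) (trans (cong (s ++_) (sym (replicate-snoc k c))) e)))

  concat-replicate-split : (v : List B) (k m : ℕ) →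
    concat (replicate (k + suc m) v) ≡ concat (replicate k v) ++ v ++ concat (replicate m v)
  concat-replicate-split v zero m = refl
  concat-replicate-split v (suc k) m = trans (cong (v ++_) (concat-replicate-split v k m)) (sym (++-assoc v _ _))

  length-concat-replicate : (v : List B) (k : ℕ) → length (concat (replicate k v)) ≡ k * length v
  length-concat-replicate v zero = refl
  length-concat-replicate v (suc k) = trans (length-++ v) (cong (length v +_) (length-concat-replicate v k))

  drop-prefix : (α γ : List B) → drop (length α) (α ++ γ) ≡ γ
  drop-prefix [] γ = refl
  drop-prefix (a ∷ α) γ = drop-prefix α γ

  take-prefix : (γ β : List B) (n : ℕ) → take (length γ + n) (γ ++ β) ≡ γ ++ take n β
  take-prefix [] β n = refl
  take-prefix (a ∷ γ) β n = cong (a ∷_) (take-prefix γ β n)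

  take-drop-decomposition : (xs : List B) (i ℓ : ℕ) →
    xs ≡ take i xs ++ take ℓ (drop i xs) ++ drop ℓ (drop i xs)
  take-drop-decomposition xs i ℓ =
    trans (sym (take++drop≡id i xs)) (cong (take i xs ++_) (sym (take++drop≡id ℓ (drop i xs))))

  regroup : (x L M R y : List B) → x ++ (L ++ M ++ R) ++ y ≡ (x ++ L) ++ M ++ R ++ y
  regroup x L M R y =
    trans (cong (x ++_) (trans (++-assoc L _ y) (cong (L ++_) (++-assoc M R y)))) (sym (++-assoc x L _))

  length-factor : (x w y : List B) → length w ≤ length (x ++ w ++ y)
  length-factor x w y = begin
    length w                   ≤⟨ m≤m+n (length w) (length y) ⟩
    length w + length y        ≡⟨ sym (length-++ w) ⟩
    length (w ++ y)            ≤⟨ m≤n+m (length (w ++ y)) (length x) ⟩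
    length x + length (w ++ y) ≡⟨ sym (length-++ x) ⟩
    length (x ++ w ++ y)       ∎
    where open ≤-Reasoning

-- GrowthBound k m holds when a string of length m + 1 reaches length 1
-- after k pair-compression levels: either k = 0 or (4/3)^(k-1) ≤ m, written
-- without fractions as 3·4^k ≤ 3^k·4m.
GrowthBound : ℕ → ℕ → Set
GrowthBound k m = k ≡ 0 ⊎ 3 * 4 ^ k ≤ 3 ^ k * (4 * m)

GrowthBound-mono : ∀ {k m' m} → GrowthBound k m' → m' ≤ m → GrowthBound k m
GrowthBound-mono (inj₁ e) le = inj₁ e
GrowthBound-mono {k} (inj₂ h) le = inj₂ (≤-trans h (*-monoʳ-≤ (3 ^ k) (*-monoʳ-≤ 4 le)))

GrowthBound-step : ∀ {k m' m} → GrowthBound k m' → 4 * m' ≤ 3 * m → 1 ≤ m → GrowthBound (suc k) m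
GrowthBound-step (inj₁ refl) le m≥1 = inj₂ (*-monoʳ-≤ 3 (*-monoʳ-≤ 4 m≥1))
GrowthBound-step {k} {m'} {m} (inj₂ h) le m≥1 = inj₂ (begin
    3 * (4 * 4 ^ k)        ≡⟨ solve 1 (λ a → con 3 :* (con 4 :* a) := con 4 :* (con 3 :* a)) refl (4 ^ k) ⟩
    4 * (3 * 4 ^ k)        ≤⟨ *-monoʳ-≤ 4 h ⟩
    4 * (3 ^ k * (4 * m'))  ≡⟨ solve 2 (λ a b → con 4 :* (a :* (con 4 :* b)) := a :* (con 4 :* (con 4 :* b))) refl (3 ^ k) m' ⟩
    3 ^ k * (4 * (4 * m'))  ≤⟨ *-monoʳ-≤ (3 ^ k) (*-monoʳ-≤ 4 le) ⟩
    3 ^ k * (4 * (3 * m))   ≡⟨ solve 2 (λ a b → a :* (con 4 :* (con 3 :* b)) := (con 3 :* a) :* (con 4 :* b)) refl (3 ^ k) m ⟩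
    (3 * 3 ^ k) * (4 * m)  ∎)
  where open ≤-Reasoning

pair-compression-shrinks : ∀ n n' c → n' + c ≡ n → n ≤ 4 * c + 1 → 2 ≤ n →
  4 * (n' ∸ 1) ≤ 3 * (n ∸ 1) × 1 ≤ n ∸ 1
pair-compression-shrinks (suc a) zero c e h (s≤s n≥2) = z≤n , n≥2
pair-compression-shrinks (suc a) (suc b) c e h (s≤s n≥2) = +-cancelʳ-≤ a (4 * b) (3 * a) shrink , n≥2
  where
  a≤4c : a ≤ 4 * c
  a≤4c = ≤-pred (subst (suc a ≤_) (+-comm (4 * c) 1) h)
  four-a : 4 * b + 4 * c ≡ 3 * a + a
  four-a = trans (solve 2 (λ x y → con 4 :* x :+ con 4 :* y := con 3 :* (x :+ y) :+ (x :+ y)) refl b c)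
                 (cong (λ z → 3 * z + z) (suc-injective e))
  shrink : 4 * b + a ≤ 3 * a + a
  shrink = subst (4 * b + a ≤_) four-a (+-monoʳ-≤ (4 * b) a≤4c)

-- 3^(3j+r) · 2^j ≤ 4^(3j+r), since 3³ · 2 ≤ 4³.
pow3-pow2≤pow4 : ∀ j r → 3 ^ (3 * j + r) * 2 ^ j ≤ 4 ^ (3 * j + r)
pow3-pow2≤pow4 zero r = subst (_≤ 4 ^ r) (sym (*-identityʳ (3 ^ r))) (^-monoˡ-≤ r (s≤s (s≤s (s≤s z≤n))))
pow3-pow2≤pow4 (suc j) r = subst (λ z → 3 ^ z * 2 ^ suc j ≤ 4 ^ z) (sym (cong (_+ r) (*-suc 3 j))) (begin
    (3 * (3 * (3 * a))) * (2 * b) ≡⟨ solve 2 (λ x y → (con 3 :* (con 3 :* (con 3 :* x))) :* (con 2 :* y) := con 54 :* (x :* y)) refl a b ⟩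
    54 * (a * b)                  ≤⟨ *-monoʳ-≤ 54 (pow3-pow2≤pow4 j r) ⟩
    54 * c                        ≤⟨ *-monoˡ-≤ c (m≤m+n 54 10) ⟩
    64 * c                        ≡⟨ solve 1 (λ x → con 64 :* x := con 4 :* (con 4 :* (con 4 :* x))) refl c ⟩
    4 * (4 * (4 * c))             ∎)
  where
  open ≤-Reasoning
  a = 3 ^ (3 * j + r)
  b = 2 ^ j
  c = 4 ^ (3 * j + r)

<2^suc⌊log₂⌋ : ∀ N → N < 2 ^ suc ⌊log₂ N ⌋
<2^suc⌊log₂⌋ N with N <? 2 ^ suc ⌊log₂ N ⌋
... | yes p = p
... | no np = ⊥-elim (1+n≰n (subst (_≤ ⌊log₂ N ⌋) (⌊log₂[2^n]⌋≡n (suc ⌊log₂ N ⌋)) (⌊log₂⌋-mono-≤ (≮⇒≥ np))))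

GrowthBound⇒≤log : ∀ N k → GrowthBound k (N ∸ 1) → k ≤ 3 * (3 + ⌊log₂ N ⌋)
GrowthBound⇒≤log N k (inj₁ refl) = z≤n
GrowthBound⇒≤log N k (inj₂ h) with k ≤? 3 * (3 + ⌊log₂ N ⌋)
... | yes k≤ = k≤
... | no k≰ = ⊥-elim (<⇒≱ (m<m+n (4 ^ k) (≤-trans (m^n>0 4 k) (m≤m+n (4 ^ k) _))) 3·4^k≤4^k)
  where
  j = 3 + ⌊log₂ N ⌋
  k≡3j+r : 3 * j + (k ∸ 3 * j) ≡ k
  k≡3j+r = m+[n∸m]≡n (≤-trans (n≤1+n _) (≰⇒> k≰))
  4m≤2^j : 4 * (N ∸ 1) ≤ 2 ^ j
  4m≤2^j = ≤-trans (*-monoʳ-≤ 4 (≤-trans (m∸n≤m N 1) (<⇒≤ (<2^suc⌊log₂⌋ N))))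
             (≤-reflexive (solve 1 (λ x → con 4 :* (con 2 :* x) := con 2 :* (con 2 :* (con 2 :* x))) refl (2 ^ ⌊log₂ N ⌋)))
  3·4^k≤4^k : 3 * 4 ^ k ≤ 4 ^ k
  3·4^k≤4^k = ≤-trans h (≤-trans (*-monoʳ-≤ (3 ^ k) 4m≤2^j)
                (subst (λ z → 3 ^ z * 2 ^ j ≤ 4 ^ z) k≡3j+r (pow3-pow2≤pow4 j (k ∸ 3 * j))))

module _ {A : Set} (_≟A_ : DecidableEquality A) where
  open TtoG _≟A_

  valLen : List Letter → ℕ
  valLen p = length (valSeq p)

  valSeq-++ : ∀ p q → valSeq (p ++ q) ≡ valSeq p ++ valSeq q
  valSeq-++ [] q = refl
  valSeq-++ (a ∷ p) q = trans (cong (val a ++_) (valSeq-++ p q)) (sym (++-assoc (val a) (valSeq p) (valSeq q)))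

  valSeq-++₃ : ∀ p q r → valSeq (p ++ q ++ r) ≡ valSeq p ++ valSeq q ++ valSeq r
  valSeq-++₃ p q r = trans (valSeq-++ p (q ++ r)) (cong (valSeq p ++_) (valSeq-++ q r))

  valLen-++ : ∀ p q → valLen (p ++ q) ≡ valLen p + valLen q
  valLen-++ p q = trans (cong length (valSeq-++ p q)) (length-++ (valSeq p))

  valSeq-replicate : ∀ d c → valSeq (replicate d c) ≡ concat (replicate d (val c))
  valSeq-replicate zero c = refl
  valSeq-replicate (suc d) c = cong (val c ++_) (valSeq-replicate d c)

  valSeq-initial : (T : List A) → valSeq (initial T) ≡ T
  valSeq-initial [] = refl
  valSeq-initial (c ∷ T) = cong (c ∷_) (valSeq-initial T)

  node-trans : ∀ {X Y Z i j} → Node X Y i → Node Y Z j → Node X Z (i + j)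
  node-trans here m = m
  node-trans (left n) m = left (node-trans n m)
  node-trans {pair Y Y'} {_} {Z} {_} {j} (right {i = i} n) m =
    subst (Node (pair Y Y') Z) (sym (+-assoc (length (val Y)) i j)) (right (node-trans n m))
  node-trans {pow Y d} {_} {Z} {_} {j} (child {i = i} k n) m =
    subst (Node (pow Y d) Z) (sym (+-assoc (toℕ k * length (val Y)) i j)) (child k (node-trans n m))

  chain-cast : ∀ {X p i j} → i ≡ j → ChainAt X p i → ChainAt X p j
  chain-cast refl c = c

  chain-lift : ∀ {X Y} p {i j} → Node X Y i → ChainAt Y p j → ChainAt X p (i + j)
  chain-lift [] n c = tt
  chain-lift (Z ∷ p) {i} {j} n (m , c) =
    node-trans n m , chain-cast (sym (+-assoc i j (length (val Z)))) (chain-lift p n c)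

  chain-split : ∀ {X} p q {i} → ChainAt X (p ++ q) i → ChainAt X p i × ChainAt X q (i + valLen p)
  chain-split [] q {i} c = tt , chain-cast (sym (+-identityʳ i)) c
  chain-split (a ∷ p) q {i} (n , c) with chain-split p q c
  ... | c₁ , c₂ = (n , c₁) , chain-cast (trans (+-assoc i _ _) (cong (i +_) (sym (length-++ (val a))))) c₂

  chain-join : ∀ {X} p q {i} → ChainAt X p i → ChainAt X q (i + valLen p) → ChainAt X (p ++ q) i
  chain-join [] q {i} c₁ c₂ = chain-cast (+-identityʳ i) c₂
  chain-join (a ∷ p) q {i} (n , c₁) c₂ =
    n , chain-join p q c₁ (chain-cast (sym (trans (+-assoc i _ _) (cong (i +_) (sym (length-++ (val a)))))) c₂)

  chain-prefix : ∀ {X} p q {i} → ChainAt X (p ++ q) i → ChainAt X p i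
  chain-prefix p q c = proj₁ (chain-split p q c)

  chain-suffix : ∀ {X} p q {i} → ChainAt X (p ++ q) i → ChainAt X q (i + valLen p)
  chain-suffix p q c = proj₂ (chain-split p q c)

  pow-children-from : ∀ c d m k → k + m ≡ d → ChainAt (pow c d) (replicate m c) (k * length (val c))
  pow-children-from c d zero k e = tt
  pow-children-from c d (suc m) k e =
    subst (Node (pow c d) c) position (child (fromℕ< k<d) here) ,
    chain-cast (+-comm (length (val c)) (k * length (val c)))
      (pow-children-from c d m (suc k) (trans (sym (+-suc k m)) e))
    where
    k<d : k < d
    k<d = subst (k <_) e (subst (_≤ k + suc m) (+-comm k 1) (+-monoʳ-≤ k (s≤s z≤n)))
    position : toℕ (fromℕ< k<d) * length (val c) + 0 ≡ k * length (val c)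
    position = trans (+-identityʳ _) (cong (_* length (val c)) (toℕ-fromℕ< k<d))

  pow-children : ∀ {X c d i} → Node X (pow c d) i → ChainAt X (replicate d c) i
  pow-children {c = c} {d} {i} n = chain-cast (+-identityʳ i) (chain-lift (replicate d c) n (pow-children-from c d d 0 refl))

  node-occurrence : ∀ {X Y i} → Node X Y i →
    Σ (List A) λ α → Σ (List A) λ β → val X ≡ α ++ val Y ++ β × length α ≡ i
  node-occurrence here = [] , [] , sym (++-identityʳ _) , refl
  node-occurrence (left {Z = Z} {X = W} n) with node-occurrence n
  ... | α , β , e , l = α , β ++ val Z ,
        trans (cong (_++ val Z) e) (trans (++-assoc α _ (val Z)) (cong (α ++_) (++-assoc (val W) β (val Z)))) , l
  node-occurrence (right {Y = Y} n) with node-occurrence n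
  ... | α , β , e , l = val Y ++ α , β ,
        trans (cong (val Y ++_) e) (sym (++-assoc (val Y) α _)) , trans (length-++ (val Y)) (cong (length (val Y) +_) l)
  node-occurrence (child {Y = Y} {d = d} {X = W} k n) with node-occurrence n
  ... | α , β , e , l = before ++ α , β ++ after , value , trans (length-++ before) (cong₂ _+_ (length-concat-replicate (val Y) (toℕ k)) l)
    where
    m = d ∸ suc (toℕ k)
    before = concat (replicate (toℕ k) (val Y))
    after = concat (replicate m (val Y))
    d≡k+1+m : toℕ k + suc m ≡ d
    d≡k+1+m = trans (+-suc (toℕ k) m) (m+[n∸m]≡n (toℕ<n k))
    value : concat (replicate d (val Y)) ≡ (before ++ α) ++ val W ++ β ++ after
    value = begin
      concat (replicate d (val Y))                 ≡⟨ cong (λ z → concat (replicate z (val Y))) (sym d≡k+1+m) ⟩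
      concat (replicate (toℕ k + suc m) (val Y))   ≡⟨ concat-replicate-split (val Y) (toℕ k) m ⟩
      before ++ val Y ++ after                     ≡⟨ cong (λ z → before ++ z ++ after) e ⟩
      before ++ (α ++ val W ++ β) ++ after         ≡⟨ regroup before α (val W) β after ⟩
      (before ++ α) ++ val W ++ β ++ after         ∎
      where open ≡-Reasoning

  chain-occurrence : ∀ {X} p i → ChainAt X p i → take (valLen p) (drop i (val X)) ≡ valSeq p
  chain-occurrence [] i c = refl
  chain-occurrence {X} (Y ∷ p) i (n , c) with node-occurrence n | chain-occurrence p (i + length (val Y)) c
  ... | α , β , e , refl | rest =
    begin
      take (length (val Y ++ valSeq p)) (drop (length α) (val X))
    ≡⟨ cong₂ take (length-++ (val Y)) suffix ⟩
      take (length (val Y) + valLen p) (val Y ++ β)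
    ≡⟨ take-prefix (val Y) β (valLen p) ⟩
      val Y ++ take (valLen p) β
    ≡⟨ cong (λ z → val Y ++ take (valLen p) z) after-Y ⟩
      val Y ++ take (valLen p) (drop (length α + length (val Y)) (val X))
    ≡⟨ cong (val Y ++_) rest ⟩
      val Y ++ valSeq p
    ∎
    where
    open ≡-Reasoning
    suffix : drop (length α) (val X) ≡ val Y ++ β
    suffix = trans (cong (drop (length α)) e) (drop-prefix α _)
    after-Y : β ≡ drop (length α + length (val Y)) (val X)
    after-Y = trans (sym (drop-prefix (val Y) β))
                (trans (cong (drop (length (val Y))) (sym suffix)) (drop-drop (length α) (length (val Y)) (val X)))

  Block : Set
  Block = Letter × ℕ

  cons-block : Letter → List Block → List Block
  cons-block a [] = (a , 1) ∷ []
  cons-block a ((b , d) ∷ r) = if does (a ≟L b) then (b , suc d) ∷ r else (a , 1) ∷ (b , d) ∷ r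

  blocks-∷ : ∀ a u → blocks (a ∷ u) ≡ cons-block a (blocks u)
  blocks-∷ a u with blocks u
  ... | [] = refl
  ... | (b , d) ∷ r = refl

  ≟L-refl : ∀ c → (c ≟L c) ≡ yes refl
  ≟L-refl c with c ≟L c
  ... | yes refl = refl
  ... | no c≢c = ⊥-elim (c≢c refl)

  expandBlocks : List Block → List Letter
  expandBlocks = concatMap (λ (c , d) → replicate d c)

  expand-cons-block : ∀ a bs → expandBlocks (cons-block a bs) ≡ a ∷ expandBlocks bs
  expand-cons-block a [] = refl
  expand-cons-block a ((b , d) ∷ r) with a ≟L b
  ... | yes refl = refl
  ... | no _ = refl

  expand-blocks : ∀ u → expandBlocks (blocks u) ≡ u
  expand-blocks [] = refl
  expand-blocks (a ∷ u) =
    trans (cong expandBlocks (blocks-∷ a u)) (trans (expand-cons-block a (blocks u)) (cong (a ∷_) (expand-blocks u)))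

  -- A block list is maximal if exponents are positive and neighbouring
  -- letters differ; these are exactly the outputs of `blocks`.
  data Maximal : List Block → Set where
    maximal[] : Maximal []
    maximal₁ : ∀ {c d} → 1 ≤ d → Maximal ((c , d) ∷ [])
    maximal∷ : ∀ {c d c' d' r} → 1 ≤ d → c ≢ c' → Maximal ((c' , d') ∷ r) → Maximal ((c , d) ∷ (c' , d') ∷ r)

  maximal-cons-block : ∀ a bs → Maximal bs → Maximal (cons-block a bs)
  maximal-cons-block a [] m = maximal₁ (s≤s z≤n)
  maximal-cons-block a ((b , d) ∷ r) m with a ≟L b | m
  ... | yes refl | maximal₁ _ = maximal₁ (s≤s z≤n)
  ... | yes refl | maximal∷ _ ne m' = maximal∷ (s≤s z≤n) ne m'
  ... | no ne | _ = maximal∷ (s≤s z≤n) ne m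

  blocks-maximal : ∀ u → Maximal (blocks u)
  blocks-maximal [] = maximal[]
  blocks-maximal (a ∷ u) = subst Maximal (sym (blocks-∷ a u)) (maximal-cons-block a (blocks u) (blocks-maximal u))

  maximal-tail : ∀ {b r} → Maximal (b ∷ r) → Maximal r
  maximal-tail (maximal₁ _) = maximal[]
  maximal-tail (maximal∷ _ _ m) = m

  maximal-init : ∀ bs z → Maximal (bs ++ z ∷ []) → Maximal bs
  maximal-init [] z m = maximal[]
  maximal-init (b ∷ []) z (maximal∷ d≥1 _ _) = maximal₁ d≥1
  maximal-init (b ∷ b' ∷ bs) z (maximal∷ d≥1 ne m) = maximal∷ d≥1 ne (maximal-init (b' ∷ bs) z m)

  maximal-head : ∀ {c d r} → Maximal ((c , d) ∷ r) → 1 ≤ d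
  maximal-head (maximal₁ d≥1) = d≥1
  maximal-head (maximal∷ d≥1 _ _) = d≥1

  maximal-last : ∀ B c d → Maximal (B ++ (c , d) ∷ []) → 1 ≤ d
  maximal-last [] c d m = maximal-head m
  maximal-last (b ∷ B) c d m = maximal-last B c d (maximal-tail m)

  maximal-last-two : ∀ B c d c' d' → Maximal (B ++ (c , d) ∷ (c' , d') ∷ []) → c ≢ c'
  maximal-last-two [] c d c' d' (maximal∷ _ ne _) = ne
  maximal-last-two (b ∷ B) c d c' d' m = maximal-last-two B c d c' d' (maximal-tail m)

  HeadNot : Letter → List Block → Set
  HeadNot c [] = ⊤
  HeadNot c ((c' , _) ∷ _) = c ≢ c'

  blocks-replicate-++ : ∀ k c t → HeadNot c (blocks t) → blocks (replicate (suc k) c ++ t) ≡ (c , suc k) ∷ blocks t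
  blocks-replicate-++ zero c t hn = trans (blocks-∷ c t) (fresh (blocks t) hn)
    where
    fresh : ∀ bs → HeadNot c bs → cons-block c bs ≡ (c , 1) ∷ bs
    fresh [] _ = refl
    fresh ((b , d) ∷ r) c≢b with c ≟L b
    ... | yes c≡b = ⊥-elim (c≢b c≡b)
    ... | no _ = refl
  blocks-replicate-++ (suc k) c t hn
    rewrite blocks-∷ c (replicate (suc k) c ++ t) | blocks-replicate-++ k c t hn | ≟L-refl c = refl

  blocks-expand : ∀ bs → Maximal bs → blocks (expandBlocks bs) ≡ bs
  blocks-expand [] m = refl
  blocks-expand ((c , suc k) ∷ []) (maximal₁ _) = blocks-replicate-++ k c [] tt
  blocks-expand ((c , suc k) ∷ (c' , d') ∷ r) (maximal∷ _ ne m) =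
    trans (blocks-replicate-++ k c (expandBlocks ((c' , d') ∷ r)) (subst (HeadNot c) (sym rest) ne))
          (cong ((c , suc k) ∷_) rest)
    where rest = blocks-expand ((c' , d') ∷ r) m

  Separated : List Letter → List Letter → Set
  Separated s t = ∀ {s₀ t₀ a} → s ≡ s₀ ++ a ∷ [] → t ≡ a ∷ t₀ → ⊥

  cons-block-++ : ∀ a b r q → cons-block a (b ∷ r) ++ q ≡ cons-block a (b ∷ r ++ q)
  cons-block-++ a (b , d) r q with a ≟L b
  ... | yes _ = refl
  ... | no _ = refl

  blocks-head : ∀ a u → Σ ℕ λ d → Σ (List Block) λ r → blocks (a ∷ u) ≡ (a , suc d) ∷ r
  blocks-head a u = head (blocks u) (blocks-∷ a u)
    where
    head : ∀ bs → blocks (a ∷ u) ≡ cons-block a bs → Σ ℕ λ d → Σ (List Block) λ r → blocks (a ∷ u) ≡ (a , suc d) ∷ r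
    head [] e = 0 , [] , e
    head ((b , d) ∷ r) e with a ≟L b
    ... | yes refl = d , r , e
    ... | no _ = 0 , (b , d) ∷ r , e

  blocks-++ : ∀ s t → Separated s t → blocks (s ++ t) ≡ blocks s ++ blocks t
  blocks-++ [] t _ = refl
  blocks-++ (a ∷ []) [] _ = sym (++-identityʳ _)
  blocks-++ (a ∷ []) (b ∷ t) sep with blocks-head b t
  ... | d , r , e rewrite blocks-∷ a (b ∷ t) | e with a ≟L b
  ...   | yes a≡b = ⊥-elim (sep {[]} {t} {a} refl (cong (_∷ t) (sym a≡b)))
  ...   | no _ = refl
  blocks-++ (a ∷ a' ∷ s) t sep
    with blocks-head a' s | blocks-++ (a' ∷ s) t (λ {s₀} e₁ e₂ → sep {a ∷ s₀} (cong (a ∷_) e₁) e₂)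
  ... | d , r , e | rest =
    begin
      blocks (a ∷ a' ∷ s ++ t)                        ≡⟨ blocks-∷ a (a' ∷ s ++ t) ⟩
      cons-block a (blocks (a' ∷ s ++ t))             ≡⟨ cong (cons-block a) rest ⟩
      cons-block a (blocks (a' ∷ s) ++ blocks t)      ≡⟨ cong (λ z → cons-block a (z ++ blocks t)) e ⟩
      cons-block a ((a' , suc d) ∷ r ++ blocks t)     ≡⟨ sym (cons-block-++ a (a' , suc d) r (blocks t)) ⟩
      cons-block a ((a' , suc d) ∷ r) ++ blocks t     ≡⟨ cong (λ z → cons-block a z ++ blocks t) (sym e) ⟩
      cons-block a (blocks (a' ∷ s)) ++ blocks t      ≡⟨ cong (_++ blocks t) (sym (blocks-∷ a (a' ∷ s))) ⟩
      blocks (a ∷ a' ∷ s) ++ blocks t                 ∎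
    where open ≡-Reasoning

  HasLongBlock : Letter → List Block → Set
  HasLongBlock c bs = Any (λ bd → Σ ℕ λ k → bd ≡ (c , suc (suc k))) bs

  long-block-cons : ∀ c a bs → HasLongBlock c bs → HasLongBlock c (cons-block a bs)
  long-block-cons c a ((b , d) ∷ r) h with a ≟L b
  long-block-cons c a ((b , d) ∷ r) (here (k , refl)) | yes refl = here (suc k , refl)
  long-block-cons c a ((b , d) ∷ r) (there h) | yes refl = there h
  ... | no _ = there h

  repeated-letter-long-block : ∀ s c t → HasLongBlock c (blocks (s ++ c ∷ c ∷ t))
  repeated-letter-long-block [] c t with blocks-head c t
  ... | d , r , e rewrite blocks-∷ c (c ∷ t) | e | ≟L-refl c = here (d , refl)
  repeated-letter-long-block (a ∷ s) c t =
    subst (HasLongBlock c) (sym (blocks-∷ a (s ++ c ∷ c ∷ t))) (long-block-cons c a _ (repeated-letter-long-block s c t))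

  long-block-inB : ∀ u c → HasLongBlock c (blocks u) → inB u c ≡ true
  long-block-inB u c = found (blocks u)
    where
    found : ∀ bs → HasLongBlock c bs → any (λ bd → does (c ≟L proj₁ bd) ∧ (2 ≤ᵇ proj₂ bd)) bs ≡ true
    found .((c , suc (suc k)) ∷ _) (here (k , refl)) rewrite ≟L-refl c = refl
    found (b ∷ bs) (there h) rewrite found bs h = ∨-zeroʳ _

  no-repeat-outside-B : ∀ u c s t → u ≡ s ++ c ∷ c ∷ t → inB u c ≡ false → ⊥
  no-repeat-outside-B u c s t refl notB
    with trans (sym notB) (long-block-inB u c (repeated-letter-long-block s c t))
  ... | ()

  length-cons-block : ∀ a bs → length (cons-block a bs) ≤ suc (length bs)
  length-cons-block a [] = ≤-refl
  length-cons-block a ((b , d) ∷ r) with a ≟L b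
  ... | yes _ = n≤1+n _
  ... | no _ = ≤-refl

  numBlocks≤length : ∀ u → numBlocks u ≤ length u
  numBlocks≤length [] = z≤n
  numBlocks≤length (a ∷ u) rewrite blocks-∷ a u = ≤-trans (length-cons-block a (blocks u)) (s≤s (numBlocks≤length u))

  numBlocks-replicate : ∀ d c → numBlocks (replicate d c) ≤ 1
  numBlocks-replicate zero c = z≤n
  numBlocks-replicate (suc k) c =
    ≤-reflexive (cong length (trans (cong blocks (sym (++-identityʳ (replicate (suc k) c)))) (blocks-replicate-++ k c [] tt)))

  numBlocks-++ : ∀ p q → numBlocks (p ++ q) ≤ numBlocks p + numBlocks q
  numBlocks-++ [] q = ≤-refl
  numBlocks-++ (a ∷ []) q rewrite blocks-∷ a q = length-cons-block a (blocks q)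
  numBlocks-++ (a ∷ a' ∷ p) q with blocks-head a' (p ++ q) | blocks-head a' p | numBlocks-++ (a' ∷ p) q
  ... | e , X , eX | e' , Y , eY | rest
    rewrite blocks-∷ a (a' ∷ p ++ q) | blocks-∷ a (a' ∷ p) | eX | eY with a ≟L a'
  ...   | yes _ = rest
  ...   | no _ = s≤s rest

  PairSeparated : (Letter → Bool) → List Letter → List Letter → Set
  PairSeparated p s t = ∀ {s₀ t₀ a b} → s ≡ s₀ ++ a ∷ [] → t ≡ b ∷ t₀ → inLR p a b ≡ false

  if-elim : ∀ {B : Set} (P : B → Set) (bo : Bool) {x y : B} → P x → P y → P (if bo then x else y)
  if-elim P true px py = px
  if-elim P false px py = py

  pcomp-++ : ∀ p s t → PairSeparated p s t → pcomp p (s ++ t) ≡ pcomp p s ++ pcomp p t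
  pcomp-++ p [] t sep = refl
  pcomp-++ p (a ∷ []) [] sep = refl
  pcomp-++ p (a ∷ []) (b ∷ t) sep rewrite sep {[]} {t} {a} {b} refl refl = refl
  pcomp-++ p (a ∷ b ∷ s) t sep
    with inLR p a b
       | pcomp-++ p s t (λ {s₀} e₁ e₂ → sep {a ∷ b ∷ s₀} (cong (λ z → a ∷ b ∷ z) e₁) e₂)
       | pcomp-++ p (b ∷ s) t (λ {s₀} e₁ e₂ → sep {a ∷ s₀} (cong (a ∷_) e₁) e₂)
  ... | true | rest | _ = cong (pair a b ∷_) rest
  ... | false | _ | rest = cong (a ∷_) rest

  pcomp-val : ∀ p u → valSeq (pcomp p u) ≡ valSeq u
  pcomp-val p [] = refl
  pcomp-val p (a ∷ []) = refl
  pcomp-val p (a ∷ b ∷ u) =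
    if-elim (λ z → valSeq z ≡ valSeq (a ∷ b ∷ u)) (inLR p a b)
      (trans (++-assoc (val a) (val b) _) (cong (λ z → val a ++ val b ++ z) (pcomp-val p u)))
      (cong (val a ++_) (pcomp-val p (b ∷ u)))

  -- A chain labelled with the compressed string refines to one labelled with
  -- the original string: the two children of a node ab are consecutive nodes.
  pcomp-chain : ∀ {X} p u {i} → ChainAt X (pcomp p u) i → ChainAt X u i
  pcomp-chain p [] c = c
  pcomp-chain p (a ∷ []) c = c
  pcomp-chain {X} p (a ∷ b ∷ u) {i} = refine (pcomp-chain p u) (pcomp-chain p (b ∷ u))
    where
    refine : (∀ {j} → ChainAt X (pcomp p u) j → ChainAt X u j) →
             (∀ {j} → ChainAt X (pcomp p (b ∷ u)) j → ChainAt X (b ∷ u) j) →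
             ChainAt X (pcomp p (a ∷ b ∷ u)) i → ChainAt X (a ∷ b ∷ u) i
    refine rest₂ rest₁ c with inLR p a b | c
    ... | true | n , c' =
      subst (Node X a) (+-identityʳ i) (node-trans n (left here)) ,
      subst (Node X b) (cong (i +_) (+-identityʳ _)) (node-trans n (right here)) ,
      chain-cast (trans (cong (i +_) (length-++ (val a))) (sym (+-assoc i _ _))) (rest₂ c')
    ... | false | n , c' = n , rest₁ c'

  -- A letter of R cannot start a pair of LR.
  pairCount-from-R : ∀ p b v → p b ≡ false → pairCount p (b ∷ v) ≡ pairCount p v
  pairCount-from-R p b [] e = refl
  pairCount-from-R p b (c ∷ v) e rewrite e = refl

  pcomp-length : ∀ p u → length (pcomp p u) + pairCount p u ≡ length u
  pcomp-length p [] = refl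
  pcomp-length p (a ∷ []) = refl
  pcomp-length p (a ∷ b ∷ u) with p a | p b in pb | pcomp-length p u | pcomp-length p (b ∷ u)
  ... | true | false | rest | _ rewrite pairCount-from-R p b u pb = cong suc (trans (+-suc _ _) (cong suc rest))
  ... | true | true | _ | rest = cong suc rest
  ... | false | _ | _ | rest = cong suc rest

  compress-block : Block → List Letter
  compress-block (c , d) = if 2 ≤ᵇ d then pow c d ∷ [] else c ∷ []

  compress-block-val : ∀ c d → 1 ≤ d → valSeq (compress-block (c , d)) ≡ valSeq (replicate d c)
  compress-block-val c (suc zero) _ = refl
  compress-block-val c (suc (suc k)) _ = trans (++-identityʳ _) (sym (valSeq-replicate (suc (suc k)) c))

  compressBlocks-val : ∀ bs → Maximal bs → valSeq (compressBlocks bs) ≡ valSeq (expandBlocks bs)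
  compressBlocks-val [] _ = refl
  compressBlocks-val ((c , d) ∷ bs) m =
    trans (valSeq-++ (compress-block (c , d)) (compressBlocks bs))
      (trans (cong₂ _++_ (compress-block-val c d (maximal-head m)) (compressBlocks-val bs (maximal-tail m)))
             (sym (valSeq-++ (replicate d c) (expandBlocks bs))))

  bcomp-val : ∀ u → valSeq (bcomp u) ≡ valSeq u
  bcomp-val u = trans (compressBlocks-val (blocks u) (blocks-maximal u)) (cong valSeq (expand-blocks u))

  compress-block-chain : ∀ {X} c d {i} → 1 ≤ d → ChainAt X (compress-block (c , d)) i → ChainAt X (replicate d c) i
  compress-block-chain c (suc zero) _ ch = ch
  compress-block-chain c (suc (suc k)) _ (n , tt) = pow-children n

  compressBlocks-chain : ∀ {X} bs {i} → Maximal bs → ChainAt X (compressBlocks bs) i → ChainAt X (expandBlocks bs) i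
  compressBlocks-chain [] _ ch = tt
  compressBlocks-chain ((c , d) ∷ bs) {i} m ch with chain-split (compress-block (c , d)) (compressBlocks bs) ch
  ... | c₁ , c₂ =
    chain-join (replicate d c) (expandBlocks bs) (compress-block-chain c d (maximal-head m) c₁)
      (compressBlocks-chain bs (maximal-tail m)
        (chain-cast (cong (λ z → i + length z) (compress-block-val c d (maximal-head m))) c₂))

  bcomp-chain : ∀ {X} u {i} → ChainAt X (bcomp u) i → ChainAt X u i
  bcomp-chain {X} u {i} ch =
    subst (λ z → ChainAt X z i) (expand-blocks u) (compressBlocks-chain (blocks u) (blocks-maximal u) ch)

  length-compressBlocks : ∀ bs → length (compressBlocks bs) ≡ length bs
  length-compressBlocks [] = refl
  length-compressBlocks ((c , suc (suc k)) ∷ bs) = cong suc (length-compressBlocks bs)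
  length-compressBlocks ((c , suc zero) ∷ bs) = cong suc (length-compressBlocks bs)
  length-compressBlocks ((c , zero) ∷ bs) = cong suc (length-compressBlocks bs)

  bcomp-length : ∀ u → length (bcomp u) ≤ length u
  bcomp-length u = subst (_≤ length u) (sym (length-compressBlocks (blocks u))) (numBlocks≤length u)

  applyStep-val : ∀ s u → valSeq (applyStep s u) ≡ valSeq u
  applyStep-val bstep u = bcomp-val u
  applyStep-val (pstep p) u = pcomp-val p u

  applySteps-val : ∀ ss u → valSeq (applySteps ss u) ≡ valSeq u
  applySteps-val [] u = refl
  applySteps-val (s ∷ ss) u = trans (applySteps-val ss (applyStep s u)) (applyStep-val s u)

  applyStep-chain : ∀ {X} s u {i} → ChainAt X (applyStep s u) i → ChainAt X u i
  applyStep-chain bstep u = bcomp-chain u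
  applyStep-chain (pstep p) u = pcomp-chain p u

  levels-are-chains : ∀ {X} ss u → applySteps ss u ≡ X ∷ [] → ChainAt X u 0
  levels-are-chains {X} [] u e = subst (λ z → ChainAt X z 0) (sym e) (here , tt)
  levels-are-chains (s ∷ ss) u e = applyStep-chain s u (levels-are-chains ss (applyStep s u) e)

  data PopLeftBlock (u : List Letter) : List Block → List Letter → List Block → Set where
    none : PopLeftBlock u [] [] []
    keep : ∀ {c d r} → inB u c ≡ false → PopLeftBlock u ((c , d) ∷ r) [] ((c , d) ∷ r)
    pop  : ∀ {c d r} → inB u c ≡ true → PopLeftBlock u ((c , d) ∷ r) (replicate d c) r

  popLeftB-view : ∀ u bs → PopLeftBlock u bs (proj₁ (popLeftB u bs)) (proj₂ (popLeftB u bs))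
  popLeftB-view u [] = none
  popLeftB-view u ((c , d) ∷ r) with inB u c in e
  ... | true = pop e
  ... | false = keep e

  data PopRightBlock (u : List Letter) : List Block → List Letter → List Block → Set where
    none : PopRightBlock u [] [] []
    keep : ∀ {B c d} → inB u c ≡ false → PopRightBlock u (B ++ (c , d) ∷ []) [] (B ++ (c , d) ∷ [])
    pop  : ∀ {B c d} → inB u c ≡ true → PopRightBlock u (B ++ (c , d) ∷ []) (replicate d c) B

  popRightB-view : ∀ u bs → PopRightBlock u bs (proj₁ (popRightB u bs)) (proj₂ (popRightB u bs))
  popRightB-view u bs with reverse bs in e
  ... | [] = subst (λ q → PopRightBlock u q [] []) (sym (reverse-≡[] bs e)) none
  ... | (c , d) ∷ r with inB u c in e₂
  ...   | true = subst (λ q → PopRightBlock u q (replicate d c) (reverse r)) (sym (reverse-≡∷ bs _ r e)) (pop e₂)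
  ...   | false = subst (λ q → PopRightBlock u q [] q) (sym (reverse-≡∷ bs _ r e)) (keep e₂)

  data PopLeftLetter (p : Letter → Bool) : List Letter → List Letter → List Letter → Set where
    none : PopLeftLetter p [] [] []
    keep : ∀ {a w} → p a ≡ true → PopLeftLetter p (a ∷ w) [] (a ∷ w)
    pop  : ∀ {a w} → p a ≡ false → PopLeftLetter p (a ∷ w) (a ∷ []) w

  popLeftP-view : ∀ p w → PopLeftLetter p w (proj₁ (popLeftP p w)) (proj₂ (popLeftP p w))
  popLeftP-view p [] = none
  popLeftP-view p (a ∷ w) with p a in e
  ... | true = keep e
  ... | false = pop e

  data PopRightLetter (p : Letter → Bool) : List Letter → List Letter → List Letter → Set where
    none : PopRightLetter p [] [] []
    keep : ∀ {B a} → p a ≡ false → PopRightLetter p (B ++ a ∷ []) [] (B ++ a ∷ [])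
    pop  : ∀ {B a} → p a ≡ true → PopRightLetter p (B ++ a ∷ []) (a ∷ []) B

  popRightP-view : ∀ p w → PopRightLetter p w (proj₁ (popRightP p w)) (proj₂ (popRightP p w))
  popRightP-view p w with reverse w in e
  ... | [] = subst (λ q → PopRightLetter p q [] []) (sym (reverse-≡[] w e)) none
  ... | a ∷ r with p a in e₂
  ...   | true = subst (λ q → PopRightLetter p q (a ∷ []) (reverse r)) (sym (reverse-≡∷ w a r e)) (pop e₂)
  ...   | false = subst (λ q → PopRightLetter p q [] q) (sym (reverse-≡∷ w a r e)) (keep e₂)

  pop-left-block-expand : ∀ {u bs L bs'} → PopLeftBlock u bs L bs' → expandBlocks bs ≡ L ++ expandBlocks bs'
  pop-left-block-expand none = refl
  pop-left-block-expand (keep _) = refl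
  pop-left-block-expand (pop _) = refl

  pop-right-block-expand : ∀ {u bs R bs'} → PopRightBlock u bs R bs' → expandBlocks bs ≡ expandBlocks bs' ++ R
  pop-right-block-expand none = refl
  pop-right-block-expand (keep _) = sym (++-identityʳ _)
  pop-right-block-expand (pop {B} {c} {d} _) =
    trans (concatMap-++ _ B ((c , d) ∷ [])) (cong (expandBlocks B ++_) (++-identityʳ _))

  pop-left-letter-++ : ∀ {p w L w'} → PopLeftLetter p w L w' → w ≡ L ++ w'
  pop-left-letter-++ none = refl
  pop-left-letter-++ (keep _) = refl
  pop-left-letter-++ (pop _) = refl

  pop-right-letter-++ : ∀ {p w R w'} → PopRightLetter p w R w' → w ≡ w' ++ R
  pop-right-letter-++ none = refl
  pop-right-letter-++ (keep _) = sym (++-identityʳ _)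
  pop-right-letter-++ (pop _) = refl

  pop-left-block-maximal : ∀ {u bs L bs'} → PopLeftBlock u bs L bs' → Maximal bs → Maximal bs'
  pop-left-block-maximal none m = m
  pop-left-block-maximal (keep _) m = m
  pop-left-block-maximal (pop _) m = maximal-tail m

  pop-right-block-maximal : ∀ {u bs R bs'} → PopRightBlock u bs R bs' → Maximal bs → Maximal bs'
  pop-right-block-maximal none m = m
  pop-right-block-maximal (keep _) m = m
  pop-right-block-maximal (pop {B} _) m = maximal-init B _ m

  pop-left-block-one : ∀ {u bs L bs'} → PopLeftBlock u bs L bs' → numBlocks L ≤ 1
  pop-left-block-one none = z≤n
  pop-left-block-one (keep _) = z≤n
  pop-left-block-one (pop {c} {d} _) = numBlocks-replicate d c

  pop-right-block-one : ∀ {u bs R bs'} → PopRightBlock u bs R bs' → numBlocks R ≤ 1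
  pop-right-block-one none = z≤n
  pop-right-block-one (keep _) = z≤n
  pop-right-block-one (pop {c = c} {d} _) = numBlocks-replicate d c

  pop-left-letter-one : ∀ {p w L w'} → PopLeftLetter p w L w' → numBlocks L ≤ 1
  pop-left-letter-one none = z≤n
  pop-left-letter-one (keep _) = z≤n
  pop-left-letter-one (pop _) = s≤s z≤n

  pop-right-letter-one : ∀ {p w R w'} → PopRightLetter p w R w' → numBlocks R ≤ 1
  pop-right-letter-one none = z≤n
  pop-right-letter-one (keep _) = z≤n
  pop-right-letter-one (pop _) = s≤s z≤n

  pop-right-block-nonempty : ∀ {u bs R bs'} → PopRightBlock u bs R bs' → bs' ≢ [] → bs ≢ []
  pop-right-block-nonempty none ne = ne
  pop-right-block-nonempty (keep _) ne = ne
  pop-right-block-nonempty (pop {B} _) _ e with ++-conicalʳ B _ e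
  ... | ()

  pop-right-letter-nonempty : ∀ {p w R w'} → PopRightLetter p w R w' → w' ≢ [] → w ≢ []
  pop-right-letter-nonempty none ne = ne
  pop-right-letter-nonempty (keep _) ne = ne
  pop-right-letter-nonempty (pop {B} _) _ e with ++-conicalʳ B _ e
  ... | ()

  expandBlocks-snoc : ∀ B c k → expandBlocks (B ++ (c , suc k) ∷ []) ≡ (expandBlocks B ++ replicate k c) ++ c ∷ []
  expandBlocks-snoc B c k =
    trans (concatMap-++ _ B ((c , suc k) ∷ []))
      (trans (cong (expandBlocks B ++_) (trans (++-identityʳ _) (replicate-snoc k c))) (sym (++-assoc (expandBlocks B) _ _)))

  last-of-blocks : ∀ B c k s₀ a → expandBlocks (B ++ (c , suc k) ∷ []) ≡ s₀ ++ a ∷ [] → a ≡ c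
  last-of-blocks B c k s₀ a e = sym (∷ʳ-injectiveʳ _ s₀ (trans (sym (expandBlocks-snoc B c k)) e))

  -- Left end of w at an even level: if the first block c^d of w was kept,
  -- c ∉ B(u), so the letter before w is not c (else cc occurs in u); if it
  -- was popped, the next block of w has a letter different from c.
  left-block-separated : ∀ {u bs L bs'} x y → u ≡ x ++ expandBlocks bs ++ y → Maximal bs →
    PopLeftBlock u bs L bs' → bs' ≢ [] → Separated (x ++ L) (expandBlocks bs' ++ y)
  left-block-separated x y eu m none ne = ⊥-elim (ne refl)
  left-block-separated {u} x y eu m (keep {c} {d} {r} notB) _ {s₀} {t₀} {a} e₁ e₂ with maximal-head m
  ... | s≤s {n = k} _ with ∷-injectiveˡ e₂
  ...   | refl = no-repeat-outside-B u c s₀ (replicate k c ++ expandBlocks r ++ y) (begin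
      u                                                               ≡⟨ eu ⟩
      x ++ (c ∷ replicate k c ++ expandBlocks r) ++ y                 ≡⟨ cong (_++ _) (trans (sym (++-identityʳ x)) e₁) ⟩
      (s₀ ++ c ∷ []) ++ (c ∷ replicate k c ++ expandBlocks r) ++ y    ≡⟨ ++-assoc s₀ _ _ ⟩
      s₀ ++ c ∷ c ∷ (replicate k c ++ expandBlocks r) ++ y            ≡⟨ cong (λ z → s₀ ++ c ∷ c ∷ z) (++-assoc (replicate k c) _ y) ⟩
      s₀ ++ c ∷ c ∷ replicate k c ++ expandBlocks r ++ y              ∎) notB
    where open ≡-Reasoning
  left-block-separated x y eu m (pop {r = []} _) ne = ⊥-elim (ne refl)
  left-block-separated x y eu (maximal∷ (s≤s {n = k} _) c≢c₂ m') (pop {c} {r = (c₂ , d₂) ∷ r} _) _ {s₀} {t₀} {a} e₁ e₂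
    with maximal-head m'
  ... | s≤s _ = c≢c₂ (trans (sym (last-of-replicate x k c s₀ a e₁)) (sym (∷-injectiveˡ e₂)))

  right-block-separated : ∀ {u bs R bs'} x y → u ≡ x ++ expandBlocks bs ++ y → Maximal bs →
    PopRightBlock u bs R bs' → bs' ≢ [] → Separated (expandBlocks bs') (R ++ y)
  right-block-separated x y eu m none ne = ⊥-elim (ne refl)
  right-block-separated {u} x y eu m (keep {B} {c} {d} notB) _ {s₀} {t₀} {a} e₁ refl with maximal-last B c d m
  ... | s≤s {n = k} _ with last-of-blocks B c k s₀ a e₁
  ...   | refl = no-repeat-outside-B u c (x ++ E) t₀ (begin
      u                                                    ≡⟨ eu ⟩
      x ++ expandBlocks (B ++ (c , suc k) ∷ []) ++ c ∷ t₀  ≡⟨ cong (λ z → x ++ z ++ c ∷ t₀) (expandBlocks-snoc B c k) ⟩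
      x ++ (E ++ c ∷ []) ++ c ∷ t₀                         ≡⟨ cong (x ++_) (++-assoc E (c ∷ []) (c ∷ t₀)) ⟩
      x ++ E ++ c ∷ c ∷ t₀                                 ≡⟨ sym (++-assoc x E _) ⟩
      (x ++ E) ++ c ∷ c ∷ t₀                               ∎) notB
    where
    open ≡-Reasoning
    E = expandBlocks B ++ replicate k c
  right-block-separated x y eu m (pop {B} {c} {d} _) ne {s₀} {t₀} {a} e₁ e₂ with unsnoc B ne
  ... | B₀ , (c₃ , d₃) , refl with maximal-last B₀ c₃ d₃ (maximal-init _ _ m) | maximal-last (B₀ ++ (c₃ , d₃) ∷ []) c d m
  ...   | s≤s {n = k₃} _ | s≤s _ =
    maximal-last-two B₀ c₃ d₃ c d (subst Maximal (++-assoc B₀ _ _) m)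
      (trans (sym (last-of-blocks B₀ c₃ k₃ s₀ a e₁)) (sym (∷-injectiveˡ e₂)))

  -- Left end of w at an odd level: a kept first letter lies in L, a popped
  -- one in R; in neither case does a pair of LR straddle the cut.
  left-letter-separated : ∀ {p w L w'} x y → PopLeftLetter p w L w' → w' ≢ [] → PairSeparated p (x ++ L) (w' ++ y)
  left-letter-separated x y none ne = ⊥-elim (ne refl)
  left-letter-separated {p} x y (keep pa) _ {s₀} {t₀} {a'} e₁ e₂ with ∷-injectiveˡ e₂
  ... | refl rewrite pa = ∧-zeroʳ (p a')
  left-letter-separated x y (pop pa) _ {s₀} e₁ e₂ with ∷ʳ-injectiveʳ x s₀ e₁
  ... | refl rewrite pa = refl

  right-letter-separated : ∀ {p w R w'} y → PopRightLetter p w R w' → w' ≢ [] → PairSeparated p w' (R ++ y)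
  right-letter-separated y none ne = ⊥-elim (ne refl)
  right-letter-separated y (keep {B} pa) _ {s₀} e₁ e₂ with ∷ʳ-injectiveʳ B s₀ e₁
  ... | refl rewrite pa = refl
  right-letter-separated {p} y (pop pa) _ {s₀} {t₀} {a'} e₁ e₂ with ∷-injectiveˡ e₂
  ... | refl rewrite pa = ∧-zeroʳ (p a')

  bcomp-split : ∀ {u bs L bs' R R₂} x y → u ≡ x ++ expandBlocks bs ++ y → Maximal bs →
    PopLeftBlock u bs L bs' → PopRightBlock u bs' R R₂ → R₂ ≢ [] →
    bcomp u ≡ bcomp (x ++ L) ++ compressBlocks R₂ ++ bcomp (R ++ y)
  bcomp-split {u} {bs} {L} {bs'} {R} {R₂} x y eu m vl vr ne =
    begin
      bcomp u
    ≡⟨ cong bcomp u-split ⟩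
      compressBlocks (blocks ((x ++ L) ++ expandBlocks R₂ ++ R ++ y))
    ≡⟨ cong compressBlocks (blocks-++ (x ++ L) _ sepˡ) ⟩
      compressBlocks (blocks (x ++ L) ++ blocks (expandBlocks R₂ ++ R ++ y))
    ≡⟨ cong (λ z → compressBlocks (blocks (x ++ L) ++ z)) (blocks-++ (expandBlocks R₂) (R ++ y) sepʳ) ⟩
      compressBlocks (blocks (x ++ L) ++ blocks (expandBlocks R₂) ++ blocks (R ++ y))
    ≡⟨ cong (λ z → compressBlocks (blocks (x ++ L) ++ z ++ blocks (R ++ y))) (blocks-expand R₂ m₂) ⟩
      compressBlocks (blocks (x ++ L) ++ R₂ ++ blocks (R ++ y))
    ≡⟨ concatMap-++ _ (blocks (x ++ L)) _ ⟩
      bcomp (x ++ L) ++ compressBlocks (R₂ ++ blocks (R ++ y))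
    ≡⟨ cong (bcomp (x ++ L) ++_) (concatMap-++ _ R₂ _) ⟩
      bcomp (x ++ L) ++ compressBlocks R₂ ++ bcomp (R ++ y)
    ∎
    where
    open ≡-Reasoning
    m' = pop-left-block-maximal vl m
    m₂ = pop-right-block-maximal vr m'
    remainder : expandBlocks bs' ++ y ≡ expandBlocks R₂ ++ R ++ y
    remainder = trans (cong (_++ y) (pop-right-block-expand vr)) (++-assoc (expandBlocks R₂) R y)
    u-remainder : u ≡ (x ++ L) ++ expandBlocks bs' ++ y
    u-remainder = trans eu (trans (cong (λ z → x ++ z ++ y) (pop-left-block-expand vl))
                    (trans (cong (x ++_) (++-assoc L _ y)) (sym (++-assoc x L _))))
    u-split : u ≡ (x ++ L) ++ expandBlocks R₂ ++ R ++ y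
    u-split = trans u-remainder (cong ((x ++ L) ++_) remainder)
    sepˡ : Separated (x ++ L) (expandBlocks R₂ ++ R ++ y)
    sepˡ = subst (Separated (x ++ L)) remainder (left-block-separated x y eu m vl (pop-right-block-nonempty vr ne))
    sepʳ : Separated (expandBlocks R₂) (R ++ y)
    sepʳ = right-block-separated (x ++ L) y u-remainder m' vr ne

  pcomp-split : ∀ {p u w L w' R M} x y → u ≡ x ++ w ++ y →
    PopLeftLetter p w L w' → PopRightLetter p w' R M → M ≢ [] →
    pcomp p u ≡ pcomp p (x ++ L) ++ pcomp p M ++ pcomp p (R ++ y)
  pcomp-split {p} {u} {w} {L} {w'} {R} {M} x y eu vl vr ne =
    begin
      pcomp p u                                          ≡⟨ cong (pcomp p) u-split ⟩
      pcomp p ((x ++ L) ++ M ++ R ++ y)                  ≡⟨ pcomp-++ p (x ++ L) _ sepˡ ⟩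
      pcomp p (x ++ L) ++ pcomp p (M ++ R ++ y)          ≡⟨ cong (pcomp p (x ++ L) ++_) (pcomp-++ p M (R ++ y) sepʳ) ⟩
      pcomp p (x ++ L) ++ pcomp p M ++ pcomp p (R ++ y)  ∎
    where
    open ≡-Reasoning
    remainder : w' ++ y ≡ M ++ R ++ y
    remainder = trans (cong (_++ y) (pop-right-letter-++ vr)) (++-assoc M R y)
    u-split : u ≡ (x ++ L) ++ M ++ R ++ y
    u-split = trans eu (trans (cong (λ z → x ++ z ++ y) (trans (pop-left-letter-++ vl) (cong (L ++_) (pop-right-letter-++ vr))))
                (regroup x L M R y))
    sepˡ : PairSeparated p (x ++ L) (M ++ R ++ y)
    sepˡ = subst (PairSeparated p (x ++ L)) remainder (left-letter-separated x y vl (pop-right-letter-nonempty vr ne))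
    sepʳ : PairSeparated p M (R ++ y)
    sepʳ = right-letter-separated y vr ne

  -- One level of PSeq.  At level h with T_h = u and w_h = w, PSeq pops L on
  -- the left and R on the right of w = L ++ M ++ R and continues with the
  -- compression w' = w_{h+1} of the middle M.
  record LevelSplit (s : Step) (u w : List Letter) : Set where
    field
      L M R w' : List Letter
      pseq-unfold : ∀ ss → pseq (s ∷ ss) u w ≡ L ++ pseq ss (applyStep s u) w' ++ R
      w-split : w ≡ L ++ M ++ R
      w'-val : valSeq w' ≡ valSeq M
      L-one-block : numBlocks L ≤ 1
      R-one-block : numBlocks R ≤ 1
      level-split : ∀ x y → u ≡ x ++ w ++ y → w' ≢ [] →
                    applyStep s u ≡ applyStep s (x ++ L) ++ w' ++ applyStep s (R ++ y)

  levelSplit : ∀ s u w → LevelSplit s u w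
  levelSplit bstep u w = record
    { L = proj₁ l ; M = expandBlocks (proj₂ r) ; R = proj₁ r ; w' = compressBlocks (proj₂ r)
    ; pseq-unfold = λ ss → refl
    ; w-split = trans (sym (expand-blocks w)) (trans (pop-left-block-expand vl) (cong (proj₁ l ++_) (pop-right-block-expand vr)))
    ; w'-val = compressBlocks-val (proj₂ r) (pop-right-block-maximal vr (pop-left-block-maximal vl (blocks-maximal w)))
    ; L-one-block = pop-left-block-one vl
    ; R-one-block = pop-right-block-one vr
    ; level-split = λ x y eu ne →
        bcomp-split x y (trans eu (cong (λ z → x ++ z ++ y) (sym (expand-blocks w)))) (blocks-maximal w) vl vr
          (λ e → ne (cong compressBlocks e))
    }
    where
    l = popLeftB u (blocks w)
    r = popRightB u (proj₂ l)
    vl = popLeftB-view u (blocks w)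
    vr = popRightB-view u (proj₂ l)
  levelSplit (pstep p) u w = record
    { L = proj₁ l ; M = proj₂ r ; R = proj₁ r ; w' = pcomp p (proj₂ r)
    ; pseq-unfold = λ ss → refl
    ; w-split = trans (pop-left-letter-++ vl) (cong (proj₁ l ++_) (pop-right-letter-++ vr))
    ; w'-val = pcomp-val p (proj₂ r)
    ; L-one-block = pop-left-letter-one vl
    ; R-one-block = pop-right-letter-one vr
    ; level-split = λ x y eu ne → pcomp-split x y eu vl vr (λ e → ne (cong (pcomp p) e))
    }
    where
    l = popLeftP p w
    r = popRightP p (proj₂ l)
    vl = popLeftP-view p w
    vr = popRightP-view p (proj₂ l)

  pseq-[] : ∀ ss u → pseq ss u [] ≡ []
  pseq-[] [] u = refl
  pseq-[] (bstep ∷ ss) u rewrite pseq-[] ss (bcomp u) = refl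
  pseq-[] (pstep p ∷ ss) u rewrite pseq-[] ss (pcomp p u) = refl

  unless-empty : ∀ (P : List Letter → Set) ss u w' → P [] → (w' ≢ [] → P (pseq ss u w')) → P (pseq ss u w')
  unless-empty P ss u [] p[] _ = subst P (sym (pseq-[] ss u)) p[]
  unless-empty P ss u (a ∷ w') _ p = p (λ ())

  pseq-val : ∀ ss u w → valSeq (pseq ss u w) ≡ valSeq w
  pseq-val [] u w = refl
  pseq-val (s ∷ ss) u w =
    begin
      valSeq (pseq (s ∷ ss) u w)                         ≡⟨ cong valSeq (pseq-unfold ss) ⟩
      valSeq (L ++ pseq ss (applyStep s u) w' ++ R)      ≡⟨ valSeq-++₃ L _ R ⟩
      valSeq L ++ valSeq (pseq ss (applyStep s u) w') ++ valSeq R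
        ≡⟨ cong (λ z → valSeq L ++ z ++ valSeq R) (trans (pseq-val ss (applyStep s u) w') w'-val) ⟩
      valSeq L ++ valSeq M ++ valSeq R                   ≡⟨ sym (valSeq-++₃ L M R) ⟩
      valSeq (L ++ M ++ R)                               ≡⟨ cong valSeq (sym w-split) ⟩
      valSeq w                                           ∎
    where
    open ≡-Reasoning
    open LevelSplit (levelSplit s u w)

  -- PSeq(w) has at most two blocks per level, plus the leftover w_H, which
  -- is a factor of the one-letter string T_H.
  pseq-blocks : ∀ ss u x w y → length (applySteps ss u) ≡ 1 → u ≡ x ++ w ++ y →
    numBlocks (pseq ss u w) ≤ 2 * length ss + 1
  pseq-blocks [] u x w y e refl = ≤-trans (numBlocks≤length w) (subst (length w ≤_) e (length-factor x w y))
  pseq-blocks (s ∷ ss) u x w y e eu = subst (λ z → numBlocks z ≤ 2 * length (s ∷ ss) + 1) (sym (pseq-unfold ss)) (begin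
      numBlocks (L ++ P ++ R)                    ≤⟨ numBlocks-++ L (P ++ R) ⟩
      numBlocks L + numBlocks (P ++ R)           ≤⟨ +-monoʳ-≤ (numBlocks L) (numBlocks-++ P R) ⟩
      numBlocks L + (numBlocks P + numBlocks R)  ≤⟨ +-mono-≤ L-one-block (+-mono-≤ P-blocks R-one-block) ⟩
      1 + ((2 * length ss + 1) + 1)
        ≡⟨ solve 1 (λ n → con 1 :+ ((con 2 :* n :+ con 1) :+ con 1) := con 2 :* (con 1 :+ n) :+ con 1) refl (length ss) ⟩
      2 * length (s ∷ ss) + 1                    ∎)
    where
    open ≤-Reasoning
    open LevelSplit (levelSplit s u w)
    P = pseq ss (applyStep s u) w'
    P-blocks : numBlocks P ≤ 2 * length ss + 1
    P-blocks = unless-empty (λ z → numBlocks z ≤ 2 * length ss + 1) ss (applyStep s u) w' z≤n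
                 (λ ne → pseq-blocks ss _ (applyStep s (x ++ L)) w' (applyStep s (R ++ y)) e (level-split x y eu ne))

  -- PSeq(w) labels a chain starting at the position of w: its popped parts
  -- are factors of T_h (a chain by levels-are-chains) and the middle part is
  -- a chain by induction, thanks to the level split.
  pseq-chain : ∀ {X} ss u x w y → applySteps ss u ≡ X ∷ [] → u ≡ x ++ w ++ y → ChainAt X (pseq ss u w) (valLen x)
  pseq-chain [] u x w y e refl = chain-prefix w y (chain-suffix x (w ++ y) (levels-are-chains [] (x ++ w ++ y) e))
  pseq-chain {X} (s ∷ ss) u x w y e eu =
    subst (λ z → ChainAt X z (valLen x)) (sym (pseq-unfold ss)) (chain-join L (P ++ R) L-chain (chain-join P R P-chain R-chain))
    where
    open LevelSplit (levelSplit s u w)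
    P = pseq ss (applyStep s u) w'
    u-split : u ≡ x ++ L ++ M ++ R ++ y
    u-split = trans eu (cong (x ++_) (trans (cong (_++ y) w-split) (trans (++-assoc L _ y) (cong (L ++_) (++-assoc M R y)))))
    after-x : ChainAt X (L ++ M ++ R ++ y) (valLen x)
    after-x = chain-suffix x _ (subst (λ z → ChainAt X z 0) u-split (levels-are-chains (s ∷ ss) u e))
    L-chain : ChainAt X L (valLen x)
    L-chain = chain-prefix L _ after-x
    R-chain : ChainAt X R (valLen x + valLen L + valLen P)
    R-chain = chain-cast (cong (valLen x + valLen L +_) (cong length (sym (trans (pseq-val ss (applyStep s u) w') w'-val))))
                (chain-prefix R y (chain-suffix M _ (chain-suffix L _ after-x)))
    x-compressed : valLen (applyStep s (x ++ L)) ≡ valLen x + valLen L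
    x-compressed = trans (cong length (applyStep-val s (x ++ L))) (valLen-++ x L)
    P-chain : ChainAt X P (valLen x + valLen L)
    P-chain = unless-empty (λ z → ChainAt X z (valLen x + valLen L)) ss (applyStep s u) w' tt
                (λ ne → chain-cast x-compressed
                  (pseq-chain ss _ (applyStep s (x ++ L)) w' (applyStep s (R ++ y)) e (level-split x y eu ne)))

  pairLevels : List Step → ℕ
  pairLevels [] = 0
  pairLevels (bstep ∷ ss) = pairLevels ss
  pairLevels (pstep _ ∷ ss) = suc (pairLevels ss)

  -- Levels alternate between the two kinds, so at most every other one is a
  -- block compression.
  levels≤pairLevels : ∀ u e ss → Valid u e ss → length ss ≤ 2 * pairLevels ss + (if e then 1 else 0)
  levels≤pairLevels u e [] v = z≤n
  levels≤pairLevels u true (bstep ∷ ss) (_ , _ , v) =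
    ≤-trans (s≤s (levels≤pairLevels (bcomp u) false ss v)) (≤-reflexive (trans (cong suc (+-identityʳ _)) (+-comm 1 _)))
  levels≤pairLevels u true (pstep p ∷ ss) (_ , () , _)
  levels≤pairLevels u false (bstep ∷ ss) (_ , () , _)
  levels≤pairLevels u false (pstep p ∷ ss) (_ , _ , v) =
    ≤-trans (s≤s (levels≤pairLevels (pcomp p u) true ss v))
      (≤-reflexive (solve 1 (λ x → con 1 :+ (con 2 :* x :+ con 1) := con 2 :* (con 1 :+ x) :+ con 0) refl (pairLevels ss)))

  Valid-nonempty : ∀ e ss → Valid [] e ss → ⊥
  Valid-nonempty e [] ()
  Valid-nonempty e (bstep ∷ ss) (_ , _ , v) = Valid-nonempty _ ss v
  Valid-nonempty e (pstep p ∷ ss) (_ , _ , v) = Valid-nonempty _ ss v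

  -- Block compression never lengthens the string, and each pair
  -- compression shrinks it by a factor 3/4.
  pairLevels-growth : ∀ u e ss → Valid u e ss → GrowthBound (pairLevels ss) (length u ∸ 1)
  pairLevels-growth u e [] v = inj₁ refl
  pairLevels-growth u e (bstep ∷ ss) (_ , _ , v) =
    GrowthBound-mono (pairLevels-growth (bcomp u) _ ss v) (∸-monoˡ-≤ 1 (bcomp-length u))
  pairLevels-growth u true (pstep p ∷ ss) (_ , () , _)
  pairLevels-growth [] false (pstep p ∷ ss) v = ⊥-elim (Valid-nonempty false (pstep p ∷ ss) v)
  pairLevels-growth (a ∷ []) false (pstep p ∷ ss) (≢1 , _ , _) = ⊥-elim (≢1 refl)
  pairLevels-growth u@(_ ∷ _ ∷ _) false (pstep p ∷ ss) (_ , enough-pairs , v)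
    with pair-compression-shrinks (length u) (length (pcomp p u)) (pairCount p u) (pcomp-length p u) enough-pairs (s≤s (s≤s z≤n))
  ... | shrinks , nontrivial =
    GrowthBound-step {pairLevels ss} {length (pcomp p u) ∸ 1} {length u ∸ 1} (pairLevels-growth (pcomp p u) true ss v) shrinks nontrivial

  run-length : ∀ T ss → IsRun T ss → length ss ≤ 2 * (3 * (3 + ⌊log₂ length T ⌋)) + 1
  run-length T ss run =
    ≤-trans (levels≤pairLevels (initial T) true ss run)
      (+-monoˡ-≤ 1 (*-monoʳ-≤ 2 (GrowthBound⇒≤log (length T) (pairLevels ss)
        (subst (λ n → GrowthBound (pairLevels ss) (n ∸ 1)) (length-map term T) (pairLevels-growth (initial T) true ss run)))))

  initial-++₃ : ∀ (x w y : List A) → initial (x ++ w ++ y) ≡ initial x ++ initial w ++ initial y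
  initial-++₃ x w y = trans (map-++ term x (w ++ y)) (cong (initial x ++_) (map-++ term w y))

  initial-factor : ∀ (T : List A) i ℓ →
    initial T ≡ initial (take i T) ++ initial (take ℓ (drop i T)) ++ initial (drop ℓ (drop i T))
  initial-factor T i ℓ = trans (cong initial (take-drop-decomposition T i ℓ)) (initial-++₃ (take i T) (take ℓ (drop i T)) (drop ℓ (drop i T)))

  PSeq-val : ∀ T ss w → valSeq (PSeq T ss w) ≡ w
  PSeq-val T ss w = trans (pseq-val ss (initial T) (initial w)) (valSeq-initial w)

  -- First part: PSeq(w) has at most 2·(number of levels) + 1 ≤ 39(⌊lg N⌋ + 1) blocks.
  PSeq-blocks : ∀ {X} T ss → IsRun T ss → result T ss ≡ X ∷ [] → ∀ b ℓ →
    numBlocks (PSeq T ss (take ℓ (drop b T))) ≤ 39 * (⌊log₂ length T ⌋ + 1)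
  PSeq-blocks T ss run res b ℓ = begin
      numBlocks (PSeq T ss (take ℓ (drop b T)))
    ≤⟨ pseq-blocks ss (initial T) (initial (take b T)) _ (initial (drop ℓ (drop b T))) (cong length res) (initial-factor T b ℓ) ⟩
      2 * length ss + 1
    ≤⟨ +-monoˡ-≤ 1 (*-monoʳ-≤ 2 (run-length T ss run)) ⟩
      2 * (2 * (3 * (3 + lg)) + 1) + 1
    ≡⟨ solve 1 (λ x → con 2 :* (con 2 :* (con 3 :* (con 3 :+ x)) :+ con 1) :+ con 1 := con 39 :+ con 12 :* x) refl lg ⟩
      39 + 12 * lg
    ≤⟨ +-monoʳ-≤ 39 (*-monoˡ-≤ lg (m≤m+n 12 27)) ⟩
      39 + 39 * lg
    ≡⟨ solve 1 (λ x → con 39 :+ con 39 :* x := con 39 :* (x :+ con 1)) refl lg ⟩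
      39 * (lg + 1)
    ∎
    where
    open ≤-Reasoning
    lg = ⌊log₂ length T ⌋

  occurrence-in-range : ∀ (w T : List A) i → 1 ≤ length w → OccursAt w T i → i ≤ length T
  occurrence-in-range w T i nonempty occ with i ≤? length T
  ... | yes i≤ = i≤
  ... | no i≰ = ⊥-elim (empty (subst (λ z → 1 ≤ length z) w≡[] nonempty))
    where
    w≡[] : w ≡ []
    w≡[] = trans (sym occ) (trans (cong (take (length w)) (drop-all i T (≰⇒≥ i≰))) (take-[] (length w)))
    empty : 1 ≤ length ([] {A = A}) → ⊥
    empty ()

  -- An occurrence of w at i is the factor of T₀ after x = T₀[0 .. i-1], so
  -- pseq-chain applies with |val x| = i.
  occurrence⇒chain : ∀ {X} T ss → result T ss ≡ X ∷ [] → ∀ w i → 1 ≤ length w → OccursAt w T i → ChainAt X (PSeq T ss w) i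
  occurrence⇒chain T ss res w i nonempty occ =
    chain-cast prefix-length
      (pseq-chain ss (initial T) (initial (take i T)) (initial w) (initial (drop (length w) (drop i T))) res T-split)
    where
    T-split : initial T ≡ initial (take i T) ++ initial w ++ initial (drop (length w) (drop i T))
    T-split = subst (λ z → initial T ≡ initial (take i T) ++ initial z ++ initial (drop (length w) (drop i T))) occ
                (initial-factor T i (length w))
    prefix-length : valLen (initial (take i T)) ≡ i
    prefix-length = trans (cong length (valSeq-initial (take i T)))
                      (trans (length-take i T) (m≤n⇒m⊓n≡m (occurrence-in-range w T i nonempty occ)))

  start-val : ∀ {X} T ss → result T ss ≡ X ∷ [] → val X ≡ T
  start-val {X} T ss res =
    trans (sym (++-identityʳ (val X))) (trans (cong valSeq (sym res)) (trans (applySteps-val ss (initial T)) (valSeq-initial T)))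

  -- A chain labelled PSeq(w) at i spells valSeq PSeq(w) = w at position i of val X = T.
  chain⇒occurrence : ∀ {X} T ss → result T ss ≡ X ∷ [] → ∀ w i → ChainAt X (PSeq T ss w) i → OccursAt w T i
  chain⇒occurrence T ss res w i c =
    subst (λ z → take (length z) (drop i T) ≡ z) (PSeq-val T ss w)
      (subst (λ z → take (valLen (PSeq T ss w)) (drop i z) ≡ valSeq (PSeq T ss w)) (start-val T ss res)
        (chain-occurrence (PSeq T ss w) i c))

  PSeq-occurrences : ∀ {X} T ss → result T ss ≡ X ∷ [] → ∀ b ℓ → 1 ≤ ℓ → b + ℓ ≤ length T →
    (i : ℕ) → OccursAt (take ℓ (drop b T)) T i ⇔ ChainAt X (PSeq T ss (take ℓ (drop b T))) i
  PSeq-occurrences T ss res b ℓ 1≤ℓ b+ℓ≤N i =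
    mk⇔ (occurrence⇒chain T ss res w i (subst (1 ≤_) (sym length-w) 1≤ℓ)) (chain⇒occurrence T ss res w i)
    where
    w = take ℓ (drop b T)
    length-w : length w ≡ ℓ
    length-w = trans (length-take ℓ (drop b T)) (trans (cong (ℓ ⊓_) (length-drop b T))
                 (m≤n⇒m⊓n≡m (≤-trans (≤-reflexive (sym (m+n∸m≡n b ℓ))) (∸-monoˡ-≤ b b+ℓ≤N))))

lemma11 : Σ ℕ λ C →
    (A : Set) (eq : DecidableEquality A) → let open TtoG eq in
    (T : List A) (ss : List Step) → IsRun T ss →
    (X : Letter) → result T ss ≡ X ∷ [] →
    (b ℓ : ℕ) → 1 ≤ ℓ → b + ℓ ≤ length T →
    numBlocks (PSeq T ss (take ℓ (drop b T))) ≤ C * (⌊log₂ length T ⌋ + 1)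
    × valSeq (PSeq T ss (take ℓ (drop b T))) ≡ take ℓ (drop b T)
    × ((i : ℕ) → OccursAt (take ℓ (drop b T)) T i ⇔ ChainAt X (PSeq T ss (take ℓ (drop b T))) i)
lemma11 = 39 , λ A eq T ss run X res b ℓ 1≤ℓ b+ℓ≤N →
  PSeq-blocks eq T ss run res b ℓ ,
  PSeq-val eq T ss (take ℓ (drop b T)) ,
  PSeq-occurrences eq T ss res b ℓ 1≤ℓ b+ℓ≤N
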